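{- Let $(P,\le,*)$ be a relatively pseudocomplemented poset, let $D\subseteq P$ and let $\Theta$ be a congruence on $(P,\le,*)$. Define the terms $t_1:=1$ (a constant) and $t_2(x,y_1,y_2):=\big(y_1*(y_2*x)\big)*x$. Then: (i) $t_1$ and $t_2$ are ideal terms (in the variables $y_1,y_2$ for $t_2$), i.e. $t_1=1$ and $t_2(a,1,1)=1$ for all $a\in P$; (ii) if $D$ is closed with respect to $t_1$ and $t_2$ (i.e. $1\in D$, and $t_2(a,b_1,b_2)\in D$ for all $a\in P$ and all $b_1,b_2\in D$), then $D$ is a deductive system of $(P,\le,*)$; (iii) $[1]\Theta$ is closed with respect to $t_1$ and $t_2$.
   Context: For a poset $(P,\le)$ and $x,y\in P$ let $L(x,y)=\{z\in P\mid z\le x,\ z\le y\}$ and $U(x,y)=\{z\in P\mid x\le z,\ y\le z\}$; $\operatorname{Max}A$, $\operatorname{Min}A$ are the sets of maximal, minimal elements of $A$. A poset is relatively pseudocomplemented if for all $x,y\in P$ there exists a greatest element $z$ of $P$ such that every element of $L(x,z)$ is $\le y$; this $z$ is denoted $x*y$; such a poset has a greatest element $1$. A binary relation $R$ is compatible with a map $Q\colon P^2\to 2^P$ if whenever $(a_1,b_1),(a_2,b_2)\in R$ there exist $a\in Q(a_1,a_2)$, $b\in Q(b_1,b_2)$ with $(a,b)\in R$. A congruence on $(P,\le,*)$ is an equivalence relation compatible with $(x,y)\mapsto\operatorname{Max}L(x,y)$, $(x,y)\mapsto\operatorname{Min}U(x,y)$, and with $*$ (i.e. $(a_1,b_1),(a_2,b_2)\in\Theta$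 imply $(a_1*a_2,b_1*b_2)\in\Theta$). A deductive system is a subset $D\subseteq P$ with $1\in D$ such that $x\in D$, $y\in P$, $x*y\in D$ imply $y\in D$. -}

module Defs where

open import Level using (Level; _⊔_; suc)
open import Data.Product using (Σ; _×_; _,_; ∃-syntax)
open import Relation.Binary.Core using (Rel)
open import Relation.Binary.Structures using (IsPartialOrder; IsEquivalence)
open import Relation.Binary.PropositionalEquality using (_≡_)
open import Relation.Unary using (Pred; _∈_)

-- A relatively pseudocomplemented poset (P, ≤, *), with equality on P being
-- propositional equality.  x * y is the greatest z such that every element
-- of L(x,z) is ≤ y.
record RPCPoset (c ℓ : Level) : Set (Level.suc (c ⊔ ℓ)) where
  infix 4 _≤_
  infixr 6 _*_
  field
    Carrier        : Set c
    _≤_            : Rel Carrier ℓ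
    isPartialOrder : IsPartialOrder _≡_ _≤_
    _*_            : Carrier → Carrier → Carrier
    *-sound        : ∀ x y w → w ≤ x → w ≤ x * y → w ≤ y
    *-greatest     : ∀ x y z → (∀ w → w ≤ x → w ≤ z → w ≤ y) → z ≤ x * y
    𝟙              : Carrier
    𝟙-top          : ∀ x → x ≤ 𝟙

module _ {c ℓ : Level} (P : RPCPoset c ℓ) where
  open RPCPoset P

  IsMaxL : Carrier → Carrier → Carrier → Set (c ⊔ ℓ)
  IsMaxL x y a = (a ≤ x × a ≤ y) × (∀ z → z ≤ x → z ≤ y → a ≤ z → z ≡ a)

  IsMinU : Carrier → Carrier → Carrier → Set (c ⊔ ℓ)
  IsMinU x y b = (x ≤ b × y ≤ b) × (∀ z → x ≤ z → y ≤ z → z ≤ b → z ≡ b)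

  -- R is compatible with a map Q : P² → 2^P (given as a membership predicate)
  CompatibleWith : ∀ {r} → Rel Carrier r → (Carrier → Carrier → Carrier → Set (c ⊔ ℓ)) → Set (c ⊔ ℓ ⊔ r)
  CompatibleWith R Q = ∀ a₁ b₁ a₂ b₂ → R a₁ b₁ → R a₂ b₂ →
    ∃[ a ] ∃[ b ] (Q a₁ a₂ a × Q b₁ b₂ b × R a b)

  record IsCongruence {r} (Θ : Rel Carrier r) : Set (c ⊔ ℓ ⊔ r) where
    field
      isEquivalence : IsEquivalence Θ
      compat-MaxL   : CompatibleWith Θ IsMaxL
      compat-MinU   : CompatibleWith Θ IsMinU
      compat-*      : ∀ a₁ b₁ a₂ b₂ → Θ a₁ b₁ → Θ a₂ b₂ → Θ (a₁ * a₂) (b₁ * b₂)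

  classOf𝟙 : ∀ {r} → Rel Carrier r → Pred Carrier r
  classOf𝟙 Θ z = Θ z 𝟙

  t₁ : Carrier
  t₁ = 𝟙

  t₂ : Carrier → Carrier → Carrier → Carrier
  t₂ x y₁ y₂ = (y₁ * (y₂ * x)) * x

  ClosedT : ∀ {r} → Pred Carrier r → Set (c ⊔ r)
  ClosedT D = (t₁ ∈ D) × (∀ a b₁ b₂ → b₁ ∈ D → b₂ ∈ D → t₂ a b₁ b₂ ∈ D)

  IsDeductiveSystem : ∀ {r} → Pred Carrier r → Set (c ⊔ r)
  IsDeductiveSystem D = (𝟙 ∈ D) × (∀ x y → x ∈ D → (x * y) ∈ D → y ∈ D)

{-# OPTIONS --safe #-}
module Submission where

open import Defs
open import Level using (Level)
open import Data.Product using (_×_; _,_)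
open import Relation.Binary.Core using (Rel)
open import Relation.Binary.PropositionalEquality using (_≡_; refl; subst; cong; module ≡-Reasoning)
open import Relation.Binary.Structures using (IsPartialOrder; IsEquivalence)
open import Relation.Unary using (Pred)

-- Everything rests on two identities of relative pseudocomplementation:
-- 1 * x = x, and x * y = 1 whenever x ≤ y.  The second, applied to
-- x ≤ (x * y) * y, gives t₂(y, x, x * y) = 1 * y = y, so a t₂-closed set
-- containing x and x * y contains y (modus ponens).  The first gives
-- t₂(a, 1, 1) = 1, and since t₂ is built from * alone, any congruence
-- relates t₂(a, b₁, b₂) to t₂(a, 1, 1) = 1 when b₁, b₂ ∈ [1]Θ.

module _ {c ℓ : Level} (P : RPCPoset c ℓ) where
  open RPCPoset P
  open IsPartialOrder isPartialOrder using (antisym; trans) renaming (refl to ≤-refl)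

  *-identityˡ : ∀ x → 𝟙 * x ≡ x
  *-identityˡ x = antisym (*-sound 𝟙 x (𝟙 * x) (𝟙-top _) ≤-refl)
                          (*-greatest 𝟙 x x (λ _ _ w≤x → w≤x))

  ≤⇒*≡𝟙 : ∀ {x y} → x ≤ y → x * y ≡ 𝟙
  ≤⇒*≡𝟙 {x} {y} x≤y = antisym (𝟙-top _) (*-greatest x y 𝟙 (λ _ w≤x _ → trans w≤x x≤y))

  x≤[x*y]*y : ∀ x y → x ≤ (x * y) * y
  x≤[x*y]*y x y = *-greatest (x * y) y x (λ w w≤x*y w≤x → *-sound x y w w≤x w≤x*y)

  t₂-𝟙-𝟙 : ∀ a → t₂ P a 𝟙 𝟙 ≡ 𝟙
  t₂-𝟙-𝟙 a = begin
    (𝟙 * (𝟙 * a)) * a  ≡⟨ cong (λ z → (𝟙 * z) * a) (*-identityˡ a) ⟩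
    (𝟙 * a) * a        ≡⟨ cong (_* a) (*-identityˡ a) ⟩
    a * a              ≡⟨ ≤⇒*≡𝟙 ≤-refl ⟩
    𝟙                  ∎
    where open ≡-Reasoning

  t₂-modusPonens : ∀ x y → t₂ P y x (x * y) ≡ y
  t₂-modusPonens x y = begin
    (x * ((x * y) * y)) * y  ≡⟨ cong (_* y) (≤⇒*≡𝟙 (x≤[x*y]*y x y)) ⟩
    𝟙 * y                    ≡⟨ *-identityˡ y ⟩
    y                        ∎
    where open ≡-Reasoning

  closedT⇒isDeductiveSystem : ∀ {r} (D : Pred Carrier r) → ClosedT P D → IsDeductiveSystem P D
  closedT⇒isDeductiveSystem D (𝟙∈D , t₂-closed) =
    𝟙∈D , λ x y x∈D x*y∈D → subst D (t₂-modusPonens x y) (t₂-closed y x (x * y) x∈D x*y∈D)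

  module _ {r} {Θ : Rel Carrier r} (isCongruence : IsCongruence P Θ) where
    open IsCongruence isCongruence
    open IsEquivalence isEquivalence using () renaming (refl to Θ-refl)

    t₂-congʳ : ∀ a {b₁ b₁′ b₂ b₂′} → Θ b₁ b₁′ → Θ b₂ b₂′ → Θ (t₂ P a b₁ b₂) (t₂ P a b₁′ b₂′)
    t₂-congʳ a b₁Θb₁′ b₂Θb₂′ =
      compat-* _ _ a a (compat-* _ _ _ _ b₁Θb₁′ (compat-* _ _ a a b₂Θb₂′ Θ-refl)) Θ-refl

    classOf𝟙-closedT : ClosedT P (classOf𝟙 P Θ)
    classOf𝟙-closedT = Θ-refl , λ a b₁ b₂ b₁Θ𝟙 b₂Θ𝟙 →
      subst (Θ (t₂ P a b₁ b₂)) (t₂-𝟙-𝟙 a) (t₂-congʳ a b₁Θ𝟙 b₂Θ𝟙)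

theorem4p10 : ∀ {c ℓ r : Level} (P : RPCPoset c ℓ) →
    ((t₁ P ≡ RPCPoset.𝟙 P) × (∀ a → t₂ P a (RPCPoset.𝟙 P) (RPCPoset.𝟙 P) ≡ RPCPoset.𝟙 P))
    × (∀ (D : Pred (RPCPoset.Carrier P) r) → ClosedT P D → IsDeductiveSystem P D)
    × (∀ (Θ : Rel (RPCPoset.Carrier P) r) → IsCongruence P Θ → ClosedT P (classOf𝟙 P Θ))
theorem4p10 P =
  (refl , t₂-𝟙-𝟙 P) , closedT⇒isDeductiveSystem P , λ _ → classOf𝟙-closedT P
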